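{- Every $k$-chromatic graph $G$ (i.e., $\chi(G)=k$) has $W_k$ as a minor.
   Context: All graphs are finite, simple and undirected. $W_n$ denotes the graph with vertex set $\{0,1,\dots,n-1\}$ in which vertices $i<j$ are adjacent iff $i=0$ or $j=i+1$ (a path $0,1,\dots,n-1$ plus edges from $0$ to every other vertex). A graph $M$ is a minor of $G$ if it can be obtained from $G$ by deleting vertices and edges and contracting edges. -}

module Defs where

open import Data.Nat using (ℕ; zero; suc; _<_; _<ᵇ_; _≡ᵇ_)
open import Data.Fin using (Fin; toℕ)
open import Data.Bool using (Bool; true; false; _∧_; _∨_)
open import Data.Maybe using (Maybe; just)
open import Data.Product using (Σ; ∃; _×_; _,_)
open import Relation.Binary.PropositionalEquality using (_≡_; _≢_)
open import Relation.Nullary using (¬_)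

record Graph : Set where
  field
    n   : ℕ
    adj : Fin n → Fin n → Bool

open Graph public

Edge : (G : Graph) → Fin (n G) → Fin (n G) → Set
Edge G u v = adj G u v ≡ true

IsSimple : Graph → Set
IsSimple G = (∀ u v → adj G u v ≡ adj G v u) × (∀ u → adj G u u ≡ false)

Colourable : Graph → ℕ → Set
Colourable G k =
  Σ (Fin (n G) → Fin k) λ c → ∀ u v → Edge G u v → c u ≢ c v

HasChromaticNumber : Graph → ℕ → Set
HasChromaticNumber G k = Colourable G k × (∀ j → j < k → ¬ Colourable G j)

-- The wheel-like graph W_k on {0,…,k-1}: for i < j, i ~ j iff i = 0 or j = i+1
wAdjℕ : ℕ → ℕ → Bool
wAdjℕ a b = ((a <ᵇ b) ∧ ((a ≡ᵇ 0) ∨ (b ≡ᵇ suc a))) ∨ ((b <ᵇ a) ∧ ((b ≡ᵇ 0) ∨ (a ≡ᵇ suc b)))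

W : ℕ → Graph
W k = record { n = k ; adj = λ i j → wAdjℕ (toℕ i) (toℕ j) }

data WalkIn (G : Graph) (P : Fin (n G) → Set) : Fin (n G) → Fin (n G) → Set where
  here : ∀ {a} → P a → WalkIn G P a a
  step : ∀ {a b c} → P a → Edge G a b → WalkIn G P b c → WalkIn G P a c

-- M is a minor of G, given by a model (branch sets): a partial map
-- f : V(G) → V(M); the branch set of x ∈ V(M) is f⁻¹(x). Branch sets are
-- automatically pairwise disjoint; we require them nonempty, connected
-- (inducing connected subgraphs of G), and that each edge xy of M is
-- realised by an edge of G between the branch sets of x and y.
IsMinor : Graph → Graph → Set
IsMinor M G =
  Σ (Fin (n G) → Maybe (Fin (n M))) λ f →
    (∀ x → ∃ λ a → f a ≡ just x)
  × (∀ x a b → f a ≡ just x → f b ≡ just x → WalkIn G (λ v → f v ≡ just x) a b)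
  × (∀ x y → Edge M x y →
       ∃ λ a → ∃ λ b → f a ≡ just x × f b ≡ just y × Edge G a b)

{-# OPTIONS --safe #-}
-- By induction on the number of vertices, a simple graph is j-colourable or has W (suc j) as a minor.
-- Take a maximal path p ∷ q, so that all neighbours of p lie on q. If p has fewer than j neighbours, a
-- j-colouring of G - p extends to p, and a minor of G - p is a minor of G. Otherwise contract q onto a
-- rim around the hub {p}: rim vertex ℓ (1 ≤ ℓ ≤ j) is the set of vertices u of q for which
-- min j (number of neighbours of p from u to the end of q) = ℓ. This level is non-increasing along q
-- and drops by at most one per step, so these sets are consecutive subpaths, each ending in a
-- neighbour of p.
module Submission where

open import Defs
open import Data.Bool using (Bool; true; if_then_else_)
import Data.Bool.Properties as Bool
open import Data.Fin using (Fin; zero; suc; toℕ; fromℕ<; punchIn; punchOut)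
open import Data.Fin.Properties
  using ( toℕ-injective; toℕ-fromℕ<; toℕ≤pred[n]; any?; injective⇒≤
        ; punchInᵢ≢i; punchIn-punchOut; punchOut-punchIn; punchOut-cong)
  renaming (_≟_ to _≟ᶠ_)
open import Data.List using (List; []; _∷_; length; lookup; filter; mapMaybe)
open import Data.List.Properties using (length-mapMaybe)
open import Data.List.Membership.Propositional using (_∈_; _∉_)
open import Data.List.Membership.Propositional.Properties using (∈-lookup; ∈-filter⁺)
open import Data.List.Relation.Unary.All as All using (All; [])
open import Data.List.Relation.Unary.All.Properties using (¬Any⇒All¬)
open import Data.List.Relation.Unary.Any as Any using (here; there; index)
open import Data.List.Relation.Unary.Any.Properties using (lookup-index)
open import Data.List.Relation.Unary.Linked as Linked using (Linked; []; [-]; _∷_)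
import Data.List.Relation.Unary.AllPairs as AllPairs
open import Data.List.Relation.Unary.Unique.Propositional using (Unique; []; _∷_)
open import Data.List.Relation.Unary.Unique.Propositional.Properties using (Unique[x∷xs]⇒x∉xs)
open import Data.Maybe using (Maybe; just; nothing; _>>=_; fromMaybe)
open import Data.Maybe.Properties using (just-injective)
import Data.Maybe as Maybe
open import Data.Nat using (ℕ; zero; suc; _+_; _<_; _≤_; _⊓_; z≤n; s≤s; _≤?_)
open import Data.Nat.Properties
  using ( ≤-refl; n≤1+n; ≤-antisym; ≤-trans; <-≤-trans; ≤-<-trans; <⇒≱; ≰⇒>; n<1+n; ≤-pred
        ; +-suc; m<m+n
        ; m⊓n≤m; m⊓n≤n; ⊓-monoʳ-≤; m≥n⇒m⊓n≡n; module ≤-Reasoning)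
  renaming (_≟_ to _≟ℕ_)
open import Data.Product using (∃; ∃₂; _×_; _,_; proj₁; proj₂)
open import Data.Sum using (_⊎_; inj₁; inj₂; [_,_])
import Data.Sum as Sum
open import Function using (id; _∘_)
open import Function.Definitions using (Injective)
open import Relation.Nullary using (¬_; Dec; does; yes; no; ¬?; contradiction)
open import Relation.Nullary.Decidable using (_×-dec_)
open import Relation.Binary.PropositionalEquality using (_≡_; _≢_; refl; sym; trans; cong; subst)

∈-mapMaybe⁺ : ∀ {A B : Set} {f : A → Maybe B} {x y xs} → x ∈ xs → f x ≡ just y → y ∈ mapMaybe f xs
∈-mapMaybe⁺ (here refl) fx rewrite fx = here refl
∈-mapMaybe⁺ {f = f} {xs = z ∷ _} (there x∈xs) fx with f z
... | just _  = there (∈-mapMaybe⁺ x∈xs fx)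
... | nothing = ∈-mapMaybe⁺ x∈xs fx

length<⇒∃∉ : ∀ {j} (xs : List (Fin j)) → length xs < j → ∃ (_∉ xs)
length<⇒∃∉ xs |xs|<j with any? (λ c → ¬? (Any.any? (c ≟ᶠ_) xs))
... | yes c∉xs = c∉xs
... | no ∄c∉xs = contradiction (injective⇒≤ position-injective) (<⇒≱ |xs|<j)
  where
  covered : ∀ c → c ∈ xs
  covered c with Any.any? (c ≟ᶠ_) xs
  ... | yes c∈xs = c∈xs
  ... | no c∉xs  = contradiction (c , c∉xs) ∄c∉xs

  position-injective : Injective _≡_ _≡_ (index ∘ covered)
  position-injective {c} {d} eq =
    trans (lookup-index (covered c)) (trans (cong (lookup xs) eq) (sym (lookup-index (covered d))))

Unique⇒lookup-injective : ∀ {A : Set} {xs : List A} → Unique xs → Injective _≡_ _≡_ (lookup xs)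
Unique⇒lookup-injective (_ ∷ _)  {zero}  {zero}  _  = refl
Unique⇒lookup-injective (x∉ ∷ _) {zero}  {suc j} eq = contradiction eq (All.lookup x∉ (∈-lookup j))
Unique⇒lookup-injective (x∉ ∷ _) {suc i} {zero}  eq = contradiction (sym eq) (All.lookup x∉ (∈-lookup i))
Unique⇒lookup-injective (_ ∷ xs) {suc i} {suc j} eq = cong suc (Unique⇒lookup-injective xs eq)

Unique⇒length≤ : ∀ {m} {xs : List (Fin m)} → Unique xs → length xs ≤ m
Unique⇒length≤ = injective⇒≤ ∘ Unique⇒lookup-injective

Adjacency : ℕ → Set
Adjacency m = Fin m → Fin m → Bool

graph : ∀ {m} → Adjacency m → Graph
graph {m} A = record { n = m ; adj = A }

Edge? : (G : Graph) (u v : Fin (n G)) → Dec (Edge G u v)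
Edge? G u v = adj G u v Bool.≟ true

Edge-sym : ∀ {G} → IsSimple G → ∀ {u v} → Edge G u v → Edge G v u
Edge-sym (symmetric , _) {u} {v} e = trans (symmetric v u) e

Edge-irrefl : ∀ {G} → IsSimple G → ∀ {u} → ¬ Edge G u u
Edge-irrefl (_ , irreflexive) {u} e with () ← trans (sym e) (irreflexive u)

neighboursIn : (G : Graph) → Fin (n G) → List (Fin (n G)) → List (Fin (n G))
neighboursIn G h = filter (Edge? G h)

EdgeBetween : ∀ {A : Set} (G : Graph) → (Fin (n G) → Maybe A) → A → A → Set
EdgeBetween G f x y = ∃₂ λ a b → f a ≡ just x × f b ≡ just y × Edge G a b

walk-start : ∀ {G P a b} → WalkIn G P a b → P a
walk-start (here pa)     = pa
walk-start (step pa _ _) = pa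

walk-++ : ∀ {G P a b c} → WalkIn G P a b → WalkIn G P b c → WalkIn G P a c
walk-++ (here _)      w = w
walk-++ (step pa e v) w = step pa e (walk-++ v w)

walk-reverse : ∀ {G} → IsSimple G → ∀ {P a b} → WalkIn G P a b → WalkIn G P b a
walk-reverse simple (here pa)     = here pa
walk-reverse simple (step pa e w) =
  walk-++ (walk-reverse simple w) (step (walk-start w) (Edge-sym simple e) (here pa))

walk-embed : ∀ {H G} {P : Fin (n H) → Set} {Q : Fin (n G) → Set} (ι : Fin (n H) → Fin (n G)) →
             (∀ {u v} → Edge H u v → Edge G (ι u) (ι v)) → (∀ {v} → P v → Q (ι v)) →
             ∀ {a b} → WalkIn H P a b → WalkIn G Q (ι a) (ι b)
walk-embed ι edge P⇒Q (here pa)     = here (P⇒Q pa)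
walk-embed ι edge P⇒Q (step pa e w) = step (P⇒Q pa) (edge e) (walk-embed ι edge P⇒Q w)

walk-map : ∀ {G} {P Q : Fin (n G) → Set} → (∀ {v} → P v → Q v) →
           ∀ {a b} → WalkIn G P a b → WalkIn G Q a b
walk-map = walk-embed id id

IsMinor-embed : ∀ {M H G} (ι : Fin (n H) → Fin (n G)) (ρ : Fin (n G) → Maybe (Fin (n H))) →
                (∀ i → ρ (ι i) ≡ just i) → (∀ {v i} → ρ v ≡ just i → ι i ≡ v) →
                (∀ {i j} → Edge H i j → Edge G (ι i) (ι j)) →
                IsMinor M H → IsMinor M G
IsMinor-embed {M} {H} {G} ι ρ ρ∘ι ι∘ρ edge (f , nonempty , connected , realised) =
  g , nonempty′ , connected′ , realised′
  where
  g : Fin (n G) → Maybe (Fin (n M))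
  g v = ρ v >>= f

  g∘ι : ∀ i → g (ι i) ≡ f i
  g∘ι i rewrite ρ∘ι i = refl

  g-just : ∀ {v x} → g v ≡ just x → ∃ λ i → ι i ≡ v × f i ≡ just x
  g-just {v} gv with ρ v in ρv
  ... | just i = i , ι∘ρ ρv , gv

  nonempty′ : ∀ x → ∃ λ a → g a ≡ just x
  nonempty′ x with a , fa ← nonempty x = ι a , trans (g∘ι a) fa

  connected′ : ∀ x a b → g a ≡ just x → g b ≡ just x → WalkIn G (λ v → g v ≡ just x) a b
  connected′ x a b ga gb with i , refl , fi ← g-just ga | k , refl , fk ← g-just gb =
    walk-embed ι edge (λ {v} fv → trans (g∘ι v) fv) (connected x i k fi fk)

  realised′ : ∀ x y → Edge M x y → EdgeBetween G g x y
  realised′ x y e with a , b , fa , fb , ab ← realised x y e =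
    ι a , ι b , trans (g∘ι a) fa , trans (g∘ι b) fb , edge ab

data WheelAdj (a b : ℕ) : Set where
  spoke : a ≡ 0 → 0 < b → WheelAdj a b
  rim   : 0 < a → b ≡ suc a → WheelAdj a b

WheelAdj-suc : ∀ {a b} → WheelAdj (suc a) (suc b) → WheelAdj (suc (suc a)) (suc (suc b))
WheelAdj-suc (rim _ b≡2+a) = rim (s≤s z≤n) (cong suc b≡2+a)

-- Above 0, wAdjℕ is invariant under shifting both arguments by one.
wAdjℕ⇒WheelAdj : ∀ a b → wAdjℕ a b ≡ true → WheelAdj a b ⊎ WheelAdj b a
wAdjℕ⇒WheelAdj zero          (suc b)       _ = inj₁ (spoke refl (s≤s z≤n))
wAdjℕ⇒WheelAdj (suc a)       zero          _ = inj₂ (spoke refl (s≤s z≤n))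
wAdjℕ⇒WheelAdj 1             2             _ = inj₁ (rim (s≤s z≤n) refl)
wAdjℕ⇒WheelAdj 2             1             _ = inj₂ (rim (s≤s z≤n) refl)
wAdjℕ⇒WheelAdj (suc (suc a)) (suc (suc b)) e =
  Sum.map WheelAdj-suc WheelAdj-suc (wAdjℕ⇒WheelAdj (suc a) (suc b) e)

IsMinor-W : ∀ {G k} (simple : IsSimple G) (f : Fin (n G) → Maybe (Fin k)) →
            (∀ x → ∃ λ a → f a ≡ just x) →
            (∀ x a b → f a ≡ just x → f b ≡ just x → WalkIn G (λ v → f v ≡ just x) a b) →
            (∀ x y → WheelAdj (toℕ x) (toℕ y) → EdgeBetween G f x y) →
            IsMinor (W k) G
IsMinor-W {G} simple f nonempty connected realised = f , nonempty , connected , realised-sym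
  where
  realised-sym : ∀ x y → Edge (W _) x y → EdgeBetween G f x y
  realised-sym x y e with wAdjℕ⇒WheelAdj (toℕ x) (toℕ y) e
  ... | inj₁ xy = realised x y xy
  ... | inj₂ yx with a , b , fa , fb , ab ← realised y x yx =
    b , a , fb , fa , Edge-sym {G} simple ab

rimVertex : ∀ {J} (ℓ : ℕ) → .(ℓ ≤ J) → Maybe (Fin (suc J))
rimVertex zero    _   = nothing
rimVertex (suc ℓ) ℓ<J = just (fromℕ< (s≤s ℓ<J))

rimVertex≡just⁺ : ∀ {J ℓ} .{ℓ≤J : ℓ ≤ J} {x : Fin (suc J)} →
                  0 < toℕ x → ℓ ≡ toℕ x → rimVertex ℓ ℓ≤J ≡ just x
rimVertex≡just⁺ {ℓ≤J = ℓ≤J} {suc x} _ refl = cong just (toℕ-injective (toℕ-fromℕ< (s≤s ℓ≤J)))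

rimVertex≡just⁻ : ∀ {J} ℓ .{ℓ≤J : ℓ ≤ J} {x} →
                  rimVertex ℓ ℓ≤J ≡ just x → 0 < toℕ x × ℓ ≡ toℕ x
rimVertex≡just⁻ (suc ℓ) {ℓ<J} refl rewrite toℕ-fromℕ< (s≤s ℓ<J) = s≤s z≤n , refl

_─_ : ∀ {m} → Adjacency (suc m) → Fin (suc m) → Adjacency m
(A ─ p) i j = A (punchIn p i) (punchIn p j)

─-simple : ∀ {m} {A : Adjacency (suc m)} {p} → IsSimple (graph A) → IsSimple (graph (A ─ p))
─-simple (symmetric , irreflexive) = (λ i j → symmetric _ _) , (λ i → irreflexive _)

punchOut? : ∀ {m} → Fin (suc m) → Fin (suc m) → Maybe (Fin m)
punchOut? p v with p ≟ᶠ v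
... | yes _   = nothing
... | no p≢v = just (punchOut p≢v)

punchOut?-punchIn : ∀ {m} (p : Fin (suc m)) i → punchOut? p (punchIn p i) ≡ just i
punchOut?-punchIn p i with p ≟ᶠ punchIn p i
... | yes p≡ = contradiction (sym p≡) (punchInᵢ≢i p i)
... | no _   = cong just (trans (punchOut-cong p refl) (punchOut-punchIn p))

punchOut?≡just⇒punchIn : ∀ {m} (p : Fin (suc m)) {v i} → punchOut? p v ≡ just i → punchIn p i ≡ v
punchOut?≡just⇒punchIn p {v} eq with p ≟ᶠ v
... | no p≢v with refl ← eq = punchIn-punchOut p≢v

punchOut?≡nothing⇒≡ : ∀ {m} (p : Fin (suc m)) {v} → punchOut? p v ≡ nothing → p ≡ v
punchOut?≡nothing⇒≡ p {v} eq with p ≟ᶠ v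
... | yes p≡v = p≡v

IsMinor-─ : ∀ {M m} {A : Adjacency (suc m)} {p} → IsMinor M (graph (A ─ p)) → IsMinor M (graph A)
IsMinor-─ {p = p} =
  IsMinor-embed (punchIn p) (punchOut? p) (punchOut?-punchIn p) (punchOut?≡just⇒punchIn p) id

Colourable-─ : ∀ {m j} {A : Adjacency (suc m)} → IsSimple (graph A) → ∀ p (ns : List (Fin (suc m))) →
               (∀ u → Edge (graph A) p u → u ∈ ns) → length ns < j →
               Colourable (graph (A ─ p)) j → Colourable (graph A) j
Colourable-─ {m} {j} {A} simple p ns neighbours∈ns |ns|<j (c , proper) = colour , proper′
  where
  c? : Fin (suc m) → Maybe (Fin j)
  c? v = Maybe.map c (punchOut? p v)

  free : ∃ (_∉ mapMaybe c? ns)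
  free = length<⇒∃∉ _ (≤-<-trans (length-mapMaybe c? ns) |ns|<j)

  colour : Fin (suc m) → Fin j
  colour v = fromMaybe (proj₁ free) (c? v)

  neighbour-not-free : ∀ {u i} → Edge (graph A) p u → punchOut? p u ≡ just i → c i ≢ proj₁ free
  neighbour-not-free {u} pu ρu ci≡free =
    proj₂ free (subst (_∈ mapMaybe c? ns) ci≡free
                      (∈-mapMaybe⁺ (neighbours∈ns u pu) (cong (Maybe.map c) ρu)))

  proper′ : ∀ u v → Edge (graph A) u v → colour u ≢ colour v
  proper′ u v uv with punchOut? p u in ρu | punchOut? p v in ρv
  ... | just i  | just k
    with refl ← punchOut?≡just⇒punchIn p ρu | refl ← punchOut?≡just⇒punchIn p ρv = proper i k uv
  ... | just i  | nothing with refl ← punchOut?≡nothing⇒≡ p ρv = neighbour-not-free (Edge-sym simple uv) ρu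
  ... | nothing | just k  with refl ← punchOut?≡nothing⇒≡ p ρu = neighbour-not-free uv ρv ∘ sym
  ... | nothing | nothing with refl ← punchOut?≡nothing⇒≡ p ρu | refl ← punchOut?≡nothing⇒≡ p ρv =
    contradiction uv (Edge-irrefl simple)

record MaximalPath (G : Graph) : Set where
  field
    end    : Fin (n G)
    rest   : List (Fin (n G))
    linked : Linked (Edge G) (end ∷ rest)
    unique : Unique (end ∷ rest)
    closed : ∀ u → Edge G end u → u ∈ rest

maximalPath : ∀ {G} → IsSimple G → Fin (n G) → MaximalPath G
maximalPath {G} simple v = extend (n G) v [] [-] ([] ∷ []) (m<m+n (n G) (s≤s z≤n))
  where
  extend : ∀ fuel p q → Linked (Edge G) (p ∷ q) → Unique (p ∷ q) →
           n G < fuel + length (p ∷ q) → MaximalPath G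
  extend zero       p q linked unique bound = contradiction (Unique⇒length≤ unique) (<⇒≱ bound)
  extend (suc fuel) p q linked unique bound with any? (λ u → Edge? G p u ×-dec ¬? (Any.any? (u ≟ᶠ_) (p ∷ q)))
  ... | yes (u , pu , u∉) =
    extend fuel u (p ∷ q) (Edge-sym simple pu ∷ linked) (¬Any⇒All¬ _ u∉ ∷ unique)
           (subst (n G <_) (sym (+-suc fuel _)) bound)
  ... | no ∄u = record { end = p ; rest = q ; linked = linked ; unique = unique ; closed = closed }
    where
    closed : ∀ u → Edge G p u → u ∈ q
    closed u pu with Any.any? (u ≟ᶠ_) (p ∷ q)
    ... | yes (here refl)  = contradiction pu (Edge-irrefl simple)
    ... | yes (there u∈q) = u∈q
    ... | no u∉           = contradiction (u , pu , u∉) ∄u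

module Fan {G : Graph} (simple : IsSimple G) (h : Fin (n G)) where

  degree : List (Fin (n G)) → ℕ
  degree r = length (neighboursIn G h r)

  degree-∷ : ∀ v r → Edge G h v × degree (v ∷ r) ≡ suc (degree r) ⊎ degree (v ∷ r) ≡ degree r
  degree-∷ v r with Edge? G h v
  ... | yes hv = inj₁ (hv , refl)
  ... | no _   = inj₂ refl

  degree-mono : ∀ v r → degree r ≤ degree (v ∷ r)
  degree-mono v r with Edge? G h v
  ... | yes _ = n≤1+n _
  ... | no _  = ≤-refl

  rank : List (Fin (n G)) → Fin (n G) → ℕ
  rank []      u = 0
  rank (v ∷ r) u = if does (u ≟ᶠ v) then degree (v ∷ r) else rank r u

  rank-head : ∀ v r → rank (v ∷ r) v ≡ degree (v ∷ r)
  rank-head v r with v ≟ᶠ v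
  ... | yes _   = refl
  ... | no v≢v = contradiction refl v≢v

  rank-there : ∀ {u v} r → u ≢ v → rank (v ∷ r) u ≡ rank r u
  rank-there {u} {v} r u≢v with u ≟ᶠ v
  ... | yes u≡v = contradiction u≡v u≢v
  ... | no _    = refl

  rank>0⇒∈ : ∀ r {u} → 0 < rank r u → u ∈ r
  rank>0⇒∈ (v ∷ r) {u} pos with u ≟ᶠ v
  ... | yes u≡v = here u≡v
  ... | no _    = there (rank>0⇒∈ r pos)

  rank-∷ : ∀ {u v r y} → v ∉ r → 0 < y → rank r u ≡ y → rank (v ∷ r) u ≡ y
  rank-∷ {u} {v} {r} v∉r 0<y ru = trans (rank-there r u≢v) ru
    where
    u≢v : u ≢ v
    u≢v refl = v∉r (rank>0⇒∈ r (subst (0 <_) (sym ru) 0<y))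

  rank≤degree : ∀ r u → rank r u ≤ degree r
  rank≤degree []      u = z≤n
  rank≤degree (v ∷ r) u with u ≟ᶠ v
  ... | yes _ = ≤-refl
  ... | no _  = ≤-trans (rank≤degree r u) (degree-mono v r)

  neighbour-of-rank : ∀ {r y} → Unique r → 0 < y → y ≤ degree r → ∃ λ b → rank r b ≡ y × Edge G h b
  neighbour-of-rank {[]}    _      0<y y≤0   = contradiction y≤0 (<⇒≱ 0<y)
  neighbour-of-rank {v ∷ r} {y} unique 0<y y≤deg with y ≤? degree r
  ... | yes y≤deg′ with b , rb , hb ← neighbour-of-rank (AllPairs.tail unique) 0<y y≤deg′ =
    b , rank-∷ (Unique[x∷xs]⇒x∉xs unique) 0<y rb , hb
  ... | no y≰deg′ with degree-∷ v r
  ...   | inj₁ (hv , deg≡) =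
    v , trans (rank-head v r) (≤-antisym (subst (_≤ y) (sym deg≡) (≰⇒> y≰deg′)) y≤deg) , hv
  ...   | inj₂ deg≡        = contradiction (subst (y ≤_) deg≡ y≤deg) y≰deg′

  head-edge-ranks : ∀ {v r} → Linked (Edge G) (v ∷ r) → v ∉ r → 0 < degree r →
                    ∃₂ λ a b → rank (v ∷ r) a ≡ degree r × rank (v ∷ r) b ≡ degree (v ∷ r) ×
                               Edge G a b
  head-edge-ranks {v} {w ∷ r} (vw ∷ _) v∉wr _ =
    w , v , trans (rank-there (w ∷ r) λ { refl → v∉wr (here refl) }) (rank-head w r) , rank-head v (w ∷ r) ,
    Edge-sym simple vw

  adjacent-of-ranks : ∀ {r y} → Linked (Edge G) r → Unique r → 0 < y → suc y ≤ degree r →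
                      ∃₂ λ a b → rank r a ≡ y × rank r b ≡ suc y × Edge G a b
  adjacent-of-ranks {v ∷ r} {y} linked unique 0<y 1+y≤deg with suc y ≤? degree r
  ... | yes 1+y≤deg′
    with a , b , ra , rb , ab ← adjacent-of-ranks (Linked.tail linked) (AllPairs.tail unique) 0<y 1+y≤deg′ =
    a , b , rank-∷ v∉r 0<y ra , rank-∷ v∉r (s≤s z≤n) rb , ab
    where
    v∉r : v ∉ r
    v∉r = Unique[x∷xs]⇒x∉xs unique
  ... | no 1+y≰deg′ with degree-∷ v r
  ...   | inj₂ deg≡ = contradiction (subst (suc y ≤_) deg≡ 1+y≤deg) 1+y≰deg′
  ...   | inj₁ (_ , deg≡)
    with refl ← ≤-antisym (≤-pred (≰⇒> 1+y≰deg′)) (≤-pred (subst (suc y ≤_) deg≡ 1+y≤deg))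
    with a , b , ra , rb , ab ← head-edge-ranks linked (Unique[x∷xs]⇒x∉xs unique) 0<y =
    a , b , ra , trans rb deg≡ , ab

  module _ (J : ℕ) where

    level : List (Fin (n G)) → Fin (n G) → ℕ
    level r u = J ⊓ rank r u

    level≡⇒∈ : ∀ r {u x} → 0 < x → level r u ≡ x → u ∈ r
    level≡⇒∈ r 0<x lu = rank>0⇒∈ r (<-≤-trans (subst (0 <_) (sym lu) 0<x) (m⊓n≤n J _))

    level-there : ∀ {u v} r → u ≢ v → level (v ∷ r) u ≡ level r u
    level-there r u≢v = cong (J ⊓_) (rank-there r u≢v)

    level-∷ : ∀ {u v r x} → v ∉ r → 0 < x → level r u ≡ x → level (v ∷ r) u ≡ x
    level-∷ {u} {v} {r} v∉r 0<x lu = trans (level-there r u≢v) lu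
      where
      u≢v : u ≢ v
      u≢v refl = v∉r (level≡⇒∈ r 0<x lu)

    walk-from-head : ∀ {v r x b} → Linked (Edge G) (v ∷ r) → Unique (v ∷ r) → 0 < x →
                     level (v ∷ r) v ≡ x → level (v ∷ r) b ≡ x →
                     WalkIn G (λ u → level (v ∷ r) u ≡ x) v b
    walk-from-head {v} {b = b} [-] _ 0<x lv lb with here refl ← level≡⇒∈ (v ∷ []) {b} 0<x lb = here lv
    walk-from-head {v} {w ∷ r} {x} {b} (vw ∷ linked) unique 0<x lv lb with b ≟ᶠ v
    ... | yes refl = here lv
    ... | no b≢v   =
      step lv vw (walk-map (level-∷ (Unique[x∷xs]⇒x∉xs unique) 0<x)
                           (walk-from-head linked (AllPairs.tail unique) 0<x lw lb))
      where
      -- the level is non-increasing along the path, so it is constant between v and b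
      lw : level (w ∷ r) w ≡ x
      lw = ≤-antisym
        (begin
          J ⊓ rank (w ∷ r) w      ≡⟨ cong (J ⊓_) (rank-head w r) ⟩
          J ⊓ degree (w ∷ r)      ≤⟨ ⊓-monoʳ-≤ J (degree-mono v (w ∷ r)) ⟩
          J ⊓ degree (v ∷ w ∷ r)  ≡⟨ cong (J ⊓_) (rank-head v (w ∷ r)) ⟨
          J ⊓ rank (v ∷ w ∷ r) v  ≡⟨ lv ⟩
          x                       ∎)
        (begin
          x                      ≡⟨ lb ⟨
          J ⊓ rank (w ∷ r) b     ≤⟨ ⊓-monoʳ-≤ J (rank≤degree (w ∷ r) b) ⟩
          J ⊓ degree (w ∷ r)     ≡⟨ cong (J ⊓_) (rank-head w r) ⟨
          J ⊓ rank (w ∷ r) w     ∎)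
        where open ≤-Reasoning

    level-connected : ∀ {r x a b} → Linked (Edge G) r → Unique r → 0 < x →
                      level r a ≡ x → level r b ≡ x → WalkIn G (λ u → level r u ≡ x) a b
    level-connected {[]} {a = a} _ _ 0<x la _ with () ← level≡⇒∈ [] {a} 0<x la
    level-connected {v ∷ r} {x} linked unique 0<x la lb with level (v ∷ r) v ≟ℕ x
    ... | yes lv  = walk-++ (walk-reverse simple (walk-from-head linked unique 0<x lv la))
                            (walk-from-head linked unique 0<x lv lb)
    ... | no lv≢x =
      walk-map (level-∷ (Unique[x∷xs]⇒x∉xs unique) 0<x)
               (level-connected (Linked.tail linked) (AllPairs.tail unique) 0<x (off-head la) (off-head lb))
      where
      off-head : ∀ {u} → level (v ∷ r) u ≡ x → level r u ≡ x
      off-head lu = trans (sym (level-there r λ { refl → lv≢x lu })) lu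

  module _ {q} (linked : Linked (Edge G) q) (unique : Unique q) (h∉q : h ∉ q)
           {J} (J≤degree : J ≤ degree q) where

    branch : Fin (n G) → Maybe (Fin (suc J))
    branch u = if does (u ≟ᶠ h) then just zero else rimVertex (level J q u) (m⊓n≤m J _)

    branch-hub : branch h ≡ just zero
    branch-hub with h ≟ᶠ h
    ... | yes _   = refl
    ... | no h≢h = contradiction refl h≢h

    branch-rim : ∀ {u x} → 0 < toℕ x → level J q u ≡ toℕ x → branch u ≡ just x
    branch-rim {u} 0<x lu with u ≟ᶠ h
    ... | yes refl = contradiction (level≡⇒∈ J q 0<x lu) h∉q
    ... | no _     = rimVertex≡just⁺ 0<x lu

    branch≡just : ∀ {u x} → branch u ≡ just x →
                  (u ≡ h × x ≡ zero) ⊎ (0 < toℕ x × level J q u ≡ toℕ x)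
    branch≡just {u} bu with u ≟ᶠ h
    ... | yes u≡h = inj₁ (u≡h , sym (just-injective bu))
    ... | no _ with 0<x , lu ← rimVertex≡just⁻ (level J q u) bu = inj₂ (0<x , lu)

    branch-rank : ∀ {u} (x : Fin (suc J)) → 0 < toℕ x → rank q u ≡ toℕ x → branch u ≡ just x
    branch-rank x 0<x ru = branch-rim 0<x (trans (cong (J ⊓_) ru) (m≥n⇒m⊓n≡n (toℕ≤pred[n] x)))

    toℕ≤degree : ∀ (y : Fin (suc J)) → toℕ y ≤ degree q
    toℕ≤degree y = ≤-trans (toℕ≤pred[n] y) J≤degree

    spoke-to : ∀ y → 0 < toℕ y → ∃ λ b → branch b ≡ just y × Edge G h b
    spoke-to y 0<y with b , rb , hb ← neighbour-of-rank unique 0<y (toℕ≤degree y) =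
      b , branch-rank y 0<y rb , hb

    W-minor : IsMinor (W (suc J)) G
    W-minor = IsMinor-W simple branch nonempty connected realised
      where
      nonempty : ∀ x → ∃ λ a → branch a ≡ just x
      nonempty zero    = h , branch-hub
      nonempty (suc x) with b , bb , _ ← spoke-to (suc x) (s≤s z≤n) = b , bb

      connected : ∀ x a b → branch a ≡ just x → branch b ≡ just x →
                  WalkIn G (λ v → branch v ≡ just x) a b
      connected x a b ba bb with branch≡just ba | branch≡just bb
      ... | inj₁ (refl , _)  | inj₁ (refl , _)  = here ba
      ... | inj₁ (_ , refl)  | inj₂ (() , _)
      ... | inj₂ (() , _)    | inj₁ (_ , refl)
      ... | inj₂ (0<x , la) | inj₂ (_ , lb)    =
        walk-map (branch-rim 0<x) (level-connected J linked unique 0<x la lb)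

      realised : ∀ x y → WheelAdj (toℕ x) (toℕ y) → EdgeBetween G branch x y
      realised x y (spoke x≡0 0<y)
        with refl ← toℕ-injective {j = zero} x≡0 | b , bb , hb ← spoke-to y 0<y =
        h , b , branch-hub , bb , hb
      realised x y (rim 0<x y≡1+x)
        with a , b , ra , rb , ab ← adjacent-of-ranks linked unique 0<x
                                      (subst (_≤ degree q) y≡1+x (toℕ≤degree y)) =
        a , b , branch-rank x 0<x ra ,
        branch-rank y (subst (0 <_) (sym y≡1+x) (s≤s z≤n)) (trans rb (sym y≡1+x)) , ab

colourable⊎W-minor : ∀ j {m} (A : Adjacency m) → IsSimple (graph A) →
                     Colourable (graph A) j ⊎ IsMinor (W (suc j)) (graph A)
colourable⊎W-minor j {zero}  A _      = inj₁ ((λ ()) , λ ())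
colourable⊎W-minor j {suc m} A simple with maximalPath simple zero
... | record { end = p ; rest = q ; linked = linked ; unique = unique ; closed = closed }
  with j ≤? Fan.degree simple p q
... | yes j≤degree =
  inj₂ (Fan.W-minor simple p (Linked.tail linked) (AllPairs.tail unique) (Unique[x∷xs]⇒x∉xs unique) j≤degree)
... | no j≰degree =
  Sum.map (Colourable-─ simple p (neighboursIn (graph A) p q)
                        (λ u pu → ∈-filter⁺ (Edge? (graph A) p) (closed u pu) pu) (≰⇒> j≰degree))
          IsMinor-─
          (colourable⊎W-minor j (A ─ p) (─-simple simple))

mainTheorem7 : (k : ℕ) (G : Graph) → IsSimple G → HasChromaticNumber G k → IsMinor (W k) G
mainTheorem7 zero    G _      _                = (λ _ → nothing) , (λ ()) , (λ _ _ _ ()) , (λ ())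
mainTheorem7 (suc j) G simple (_ , uncolourable) =
  [ (λ colourable → contradiction colourable (uncolourable j (n<1+n j))) , id ]
    (colourable⊎W-minor j (adj G) simple)
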